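{- Let $N$ be a natural number and let $q,z,e$ be complex numbers with $e\ne0$ and such that no denominator below vanishes. Then \[ \sum_{n=1}^{N} \begin{bmatrix} N\\ n \end{bmatrix} \frac{(q)_{n-1} z^{n} q^{n(n+1)} }{(zq)_{n} (q/e)_{n} e^n} = \sum_{n=1}^N \begin{bmatrix} N\\ n \end{bmatrix} \frac{(q)_{n-1} (zq)_{N-n} (zq)^n}{(zq)_N (q/e)_{n}} - \sum_{n=1}^N \frac{zq^{n} }{1-zq^{n}}. \]
   Context: For complex $x$: $(x)_0=1$, $(x)_n=(1-x)(1-xq)\cdots(1-xq^{n-1})$ for $n\ge1$. The $q$-binomial coefficient is $\begin{bmatrix} N\\ n \end{bmatrix}=\frac{(q)_N}{(q)_n(q)_{N-n}}$ for $0\le n\le N$ and $0$ otherwise. -}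

module Defs where

open import Level using (Level; _⊔_) renaming (suc to lsuc)
open import Data.Nat using (ℕ; zero; suc; _∸_; _≤ᵇ_) renaming (_*_ to _*ℕ_)
open import Data.Bool using (if_then_else_)
open import Relation.Nullary using (¬_)
open import Algebra.Bundles using (CommutativeRing)

-- A field: a commutative ring with 0 ≠ 1 and a (total) inverse operation
-- that is a genuine multiplicative inverse on every nonzero element.
-- (The value of 0⁻¹ is irrelevant: it never occurs, since the theorem
-- assumes all denominators are nonzero.)
record Field (c ℓ : Level) : Set (lsuc (c ⊔ ℓ)) where
  field
    commutativeRing : CommutativeRing c ℓ
  open CommutativeRing commutativeRing public
  field
    _⁻¹      : Carrier → Carrier
    0≉1      : ¬ (0# ≈ 1#)
    inverseʳ : ∀ x → ¬ (x ≈ 0#) → (x * (x ⁻¹)) ≈ 1#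

module FieldOps {c ℓ : Level} (F : Field c ℓ) where
  open Field F public

  infixl 7 _/_
  _/_ : Carrier → Carrier → Carrier
  x / y = x * (y ⁻¹)

  _^_ : Carrier → ℕ → Carrier
  x ^ zero  = 1#
  x ^ suc n = (x ^ n) * x

  poch : Carrier → Carrier → ℕ → Carrier
  poch q x zero    = 1#
  poch q x (suc n) = poch q x n * (1# - x * (q ^ n))

  qbinom : Carrier → ℕ → ℕ → Carrier
  qbinom q N n =
    if n ≤ᵇ N then poch q q N / (poch q q n * poch q q (N ∸ n)) else 0#

  sum1 : ℕ → (ℕ → Carrier) → Carrier
  sum1 zero    f = 0#
  sum1 (suc N) f = sum1 N f + f (suc N)

{-# OPTIONS --safe #-}
-- Put a = q/e and b = zq, and write qTri n = q^(n(n-1)/2). Multiplied by (b)_N, the two sums of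
-- q-binomial coefficients become Σ_n [N n] U_n (bqⁿ)_{N-n} and Σ_n [N n] V_n (b)_{N-n}, where
-- U_n = (q)_{n-1} (ab)ⁿ qTri(n)² / (a)_n and V_n = (q)_{n-1} bⁿ / (a)_n. Expanding the remaining
-- q-Pochhammer symbols by the q-binomial theorem (x)_k = Σ_j [k j] (-x)^j qTri j and exchanging the
-- order of summation, the coefficient of [N m] becomes an inner sum over n ≤ m. By induction on m,
-- where the q-Pascal rule turns the step into a telescoping sum, these inner sums are
-- -(-b)^m qTri m Σ_{k<m} aq^k/(1-aq^k) and -(-b)^m qTri m Σ_{k<m} 1/(1-aq^k). They differ by
-- m (-b)^m qTri m, and Σ_m [N m] m (-b)^m qTri m = -(b)_N Σ_{k<N} bq^k/(1-bq^k) is b d/db applied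
-- to the q-binomial theorem for (b)_N.

module Submission where

open import Defs
open import Level using (Level)
open import Data.Nat using (ℕ; _≤_; _∸_) renaming (_*_ to _*ℕ_; suc to sucℕ)
open import Relation.Nullary using (¬_)

open import Algebra.Bundles using (CommutativeRing)
import Algebra.Solver.Ring.AlmostCommutativeRing as ACR
open import Data.Bool using (true)
open import Data.Integer as ℤ using (ℤ; +_; -[1+_]; _⊖_; _◃_; sign; ∣_∣)
import Data.Integer.Properties as ℤ
open import Data.Maybe using (Maybe; just; nothing)
open import Data.Nat as ℕ using (zero; suc; _<_; z≤n; s≤s)
import Data.Nat.Properties as ℕ
open import Data.Sign as Sign using (Sign)
open import Relation.Nullary using (yes; no)
open import Relation.Binary.PropositionalEquality as ≡ using (_≡_)

-- Integer coefficients act through i ↦ i × 1#; as ℤ computes, the normal forms of the two sides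
-- of an identity can be compared by refl, which the ring's own (abstract) elements would not allow.
module IntegerCoefficientSolver {c ℓ : Level} (R : CommutativeRing c ℓ) where
  open CommutativeRing R
  open import Algebra.Properties.Ring ring
  open import Algebra.Properties.Semiring.Mult.TCOptimised semiring
  open import Relation.Binary.Reasoning.Setoid setoid

  private
    ⟦_⟧ℤ : ℤ → Carrier
    ⟦ + n ⟧ℤ      = n × 1#
    ⟦ -[1+ n ] ⟧ℤ = - (suc n × 1#)

    signed : Sign → Carrier → Carrier
    signed Sign.+ x = x
    signed Sign.- x = - x

    signed-cong : ∀ s {x y} → x ≈ y → signed s x ≈ signed s y
    signed-cong Sign.+ x≈y = x≈y
    signed-cong Sign.- x≈y = -‿cong x≈y

    signed-* : ∀ s t x y → signed (s Sign.* t) (x * y) ≈ signed s x * signed t y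
    signed-* Sign.+ Sign.+ x y = refl
    signed-* Sign.+ Sign.- x y = -‿distribʳ-* x y
    signed-* Sign.- Sign.+ x y = -‿distribˡ-* x y
    signed-* Sign.- Sign.- x y = begin
      x * y         ≈⟨ -‿involutive (x * y) ⟨
      - - (x * y)   ≈⟨ -‿cong (-‿distribˡ-* x y) ⟩
      - (- x * y)   ≈⟨ -‿distribʳ-* (- x) y ⟩
      - x * - y     ∎

    ⟦◃⟧ : ∀ s n → ⟦ s ◃ n ⟧ℤ ≈ signed s (n × 1#)
    ⟦◃⟧ Sign.+ zero    = refl
    ⟦◃⟧ Sign.- zero    = sym -0#≈0#
    ⟦◃⟧ Sign.+ (suc n) = refl
    ⟦◃⟧ Sign.- (suc n) = refl

    ⟦⊖⟧ : ∀ m n → ⟦ m ⊖ n ⟧ℤ ≈ m × 1# - n × 1#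
    ⟦⊖⟧ m       zero    = sym (trans (+-congˡ -0#≈0#) (+-identityʳ _))
    ⟦⊖⟧ zero    (suc n) = sym (+-identityˡ _)
    ⟦⊖⟧ (suc m) (suc n) = begin
      ⟦ suc m ⊖ suc n ⟧ℤ                    ≡⟨ ≡.cong ⟦_⟧ℤ (ℤ.[1+m]⊖[1+n]≡m⊖n m n) ⟩
      ⟦ m ⊖ n ⟧ℤ                            ≈⟨ ⟦⊖⟧ m n ⟩
      m × 1# - n × 1#                       ≈⟨ +-congʳ (+-identityˡ _) ⟨
      0# + m × 1# - n × 1#                  ≈⟨ +-congʳ (+-congʳ (-‿inverseʳ 1#)) ⟨
      1# - 1# + m × 1# - n × 1#             ≈⟨ +-congʳ (+-assoc 1# (- 1#) _) ⟩
      1# + (- 1# + m × 1#) - n × 1#         ≈⟨ +-congʳ (+-congˡ (+-comm (- 1#) _)) ⟩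
      1# + (m × 1# - 1#) - n × 1#           ≈⟨ +-congʳ (+-assoc 1# _ (- 1#)) ⟨
      1# + m × 1# - 1# - n × 1#             ≈⟨ +-assoc _ (- 1#) _ ⟩
      1# + m × 1# + (- 1# - n × 1#)         ≈⟨ +-cong (sym (1+× m 1#)) (-‿+-comm 1# (n × 1#)) ⟩
      suc m × 1# - (1# + n × 1#)            ≈⟨ +-congˡ (-‿cong (1+× n 1#)) ⟨
      suc m × 1# - suc n × 1#               ∎

    +-homo : ∀ i j → ⟦ i ℤ.+ j ⟧ℤ ≈ ⟦ i ⟧ℤ + ⟦ j ⟧ℤ
    +-homo (+ m)      (+ n)      = ×-homo-+ 1# m n
    +-homo (+ m)      -[1+ n ]   = ⟦⊖⟧ m (suc n)
    +-homo -[1+ m ]   (+ n)      = trans (⟦⊖⟧ n (suc m)) (+-comm _ _)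
    +-homo -[1+ m ]   -[1+ n ]   = begin
      - (suc (suc (m ℕ.+ n)) × 1#)          ≡⟨ ≡.cong (λ k → - (suc k × 1#)) (ℕ.+-suc m n) ⟨
      - ((suc m ℕ.+ suc n) × 1#)            ≈⟨ -‿cong (×-homo-+ 1# (suc m) (suc n)) ⟩
      - (suc m × 1# + suc n × 1#)           ≈⟨ -‿+-comm _ _ ⟨
      - (suc m × 1#) - suc n × 1#           ∎

    *-homo : ∀ i j → ⟦ i ℤ.* j ⟧ℤ ≈ ⟦ i ⟧ℤ * ⟦ j ⟧ℤ
    *-homo i j = begin
      ⟦ (sign i Sign.* sign j) ◃ (∣ i ∣ ℕ.* ∣ j ∣) ⟧ℤ
        ≈⟨ ⟦◃⟧ (sign i Sign.* sign j) (∣ i ∣ ℕ.* ∣ j ∣) ⟩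
      signed (sign i Sign.* sign j) ((∣ i ∣ ℕ.* ∣ j ∣) × 1#)
        ≈⟨ signed-cong (sign i Sign.* sign j) (×1-homo-* ∣ i ∣ ∣ j ∣) ⟩
      signed (sign i Sign.* sign j) (∣ i ∣ × 1# * ∣ j ∣ × 1#)
        ≈⟨ signed-* (sign i) (sign j) _ _ ⟩
      signed (sign i) (∣ i ∣ × 1#) * signed (sign j) (∣ j ∣ × 1#)
        ≈⟨ *-cong (signed-sign-abs i) (signed-sign-abs j) ⟩
      ⟦ i ⟧ℤ * ⟦ j ⟧ℤ ∎
      where
      signed-sign-abs : ∀ i → signed (sign i) (∣ i ∣ × 1#) ≈ ⟦ i ⟧ℤ
      signed-sign-abs (+ n)    = refl
      signed-sign-abs -[1+ n ] = refl

    -‿homo : ∀ i → ⟦ ℤ.- i ⟧ℤ ≈ - ⟦ i ⟧ℤ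
    -‿homo (+ zero)  = sym -0#≈0#
    -‿homo (+ suc n) = refl
    -‿homo -[1+ n ]  = sym (-‿involutive _)

    homomorphism : ℤ.+-*-rawRing ACR.-Raw-AlmostCommutative⟶ ACR.fromCommutativeRing R
    homomorphism = record
      { ⟦_⟧ = ⟦_⟧ℤ ; +-homo = +-homo ; *-homo = *-homo ; -‿homo = -‿homo
      ; 0-homo = refl ; 1-homo = refl }

    coefficients≟ : ∀ i j → Maybe (⟦ i ⟧ℤ ≈ ⟦ j ⟧ℤ)
    coefficients≟ i j with i ℤ.≟ j
    ... | yes ≡.refl = just refl
    ... | no _       = nothing

  open import Algebra.Solver.Ring ℤ.+-*-rawRing (ACR.fromCommutativeRing R) homomorphism coefficients≟ public

  𝟘 𝟙 : ∀ {n} → Polynomial n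
  𝟘 = con (+ 0)
  𝟙 = con (+ 1)

module Sums {c ℓ : Level} (R : CommutativeRing c ℓ) where
  open CommutativeRing R
  open IntegerCoefficientSolver R
  open import Relation.Binary.Reasoning.Setoid setoid

  ∑< : ℕ → (ℕ → Carrier) → Carrier
  ∑< zero    f = 0#
  ∑< (suc n) f = ∑< n f + f n

  syntax ∑< n (λ i → e) = ∑[ i < n ] e

  ∑-cong : ∀ n {f g : ℕ → Carrier} → (∀ i → i < n → f i ≈ g i) → ∑< n f ≈ ∑< n g
  ∑-cong zero    f≈g = refl
  ∑-cong (suc n) f≈g = +-cong (∑-cong n (λ i i<n → f≈g i (ℕ.m<n⇒m<1+n i<n))) (f≈g n ℕ.≤-refl)

  ∑-distrib-+ : ∀ n (f g : ℕ → Carrier) → ∑[ i < n ] (f i + g i) ≈ ∑< n f + ∑< n g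
  ∑-distrib-+ zero    f g = sym (+-identityˡ 0#)
  ∑-distrib-+ (suc n) f g = begin
    ∑[ i < n ] (f i + g i) + (f n + g n)
      ≈⟨ +-congʳ (∑-distrib-+ n f g) ⟩
    ∑< n f + ∑< n g + (f n + g n)
      ≈⟨ solve 4 (λ a b c d → a :+ b :+ (c :+ d) := a :+ c :+ (b :+ d)) refl (∑< n f) (∑< n g) (f n) (g n) ⟩
    ∑< n f + f n + (∑< n g + g n)
      ∎

  *-distribˡ-∑ : ∀ n x (f : ℕ → Carrier) → x * ∑< n f ≈ ∑[ i < n ] (x * f i)
  *-distribˡ-∑ zero    x f = zeroʳ x
  *-distribˡ-∑ (suc n) x f = trans (distribˡ x _ _) (+-congʳ (*-distribˡ-∑ n x f))

  ∑-neg : ∀ n (f : ℕ → Carrier) → ∑[ i < n ] (- f i) ≈ - ∑< n f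
  ∑-neg zero    f = solve 0 (𝟘 := :- 𝟘) refl
  ∑-neg (suc n) f = trans (+-congʳ (∑-neg n f)) (solve 2 (λ s x → :- s :- x := :- (s :+ x)) refl (∑< n f) (f n))

  ∑-split-first : ∀ n (f : ℕ → Carrier) → ∑< (suc n) f ≈ f 0 + ∑[ i < n ] f (suc i)
  ∑-split-first zero    f = trans (+-identityˡ _) (sym (+-identityʳ _))
  ∑-split-first (suc n) f = trans (+-congʳ (∑-split-first n f)) (+-assoc _ _ _)

  ∑-shift : ∀ n (f : ℕ → Carrier) → f 0 ≈ 0# → f (suc n) ≈ 0# → ∑[ i < suc n ] f (suc i) ≈ ∑< (suc n) f
  ∑-shift n f f0≈0 fn≈0 = begin
    ∑[ i < suc n ] f (suc i)             ≈⟨ +-identityˡ _ ⟨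
    0# + ∑[ i < suc n ] f (suc i)        ≈⟨ +-congʳ f0≈0 ⟨
    f 0 + ∑[ i < suc n ] f (suc i)       ≈⟨ ∑-split-first (suc n) f ⟨
    ∑< (suc n) f + f (suc n)             ≈⟨ +-congˡ fn≈0 ⟩
    ∑< (suc n) f + 0#                    ≈⟨ +-identityʳ _ ⟩
    ∑< (suc n) f                         ∎

  ∑-telescope : ∀ n (t u : ℕ → Carrier) → (∀ i → i < n → t i ≈ u i - u (suc i)) → ∑< n t ≈ u 0 - u n
  ∑-telescope zero    t u t≈Δu = sym (-‿inverseʳ (u 0))
  ∑-telescope (suc n) t u t≈Δu = begin
    ∑< n t + t n                         ≈⟨ +-cong (∑-telescope n t u (λ i i<n → t≈Δu i (ℕ.m<n⇒m<1+n i<n))) (t≈Δu n ℕ.≤-refl) ⟩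
    (u 0 - u n) + (u n - u (suc n))      ≈⟨ solve 3 (λ a b c → (a :- b) :+ (b :- c) := a :- c) refl (u 0) (u n) (u (suc n)) ⟩
    u 0 - u (suc n)                      ∎

  ∑-triangle : ∀ N (f : ℕ → ℕ → Carrier) →
               ∑[ n < suc N ] ∑< (suc (N ∸ n)) (f n) ≈ ∑[ m < suc N ] ∑[ n < suc m ] f n (m ∸ n)
  ∑-triangle zero    f = refl
  ∑-triangle (suc N) f = begin
    ∑[ n < suc N ] ∑< (suc (suc N ∸ n)) (f n) + ∑< (suc (suc N ∸ suc N)) (f (suc N))
      ≈⟨ +-cong (∑-cong (suc N) split-last) last-row ⟩
    ∑[ n < suc N ] (∑< (suc (N ∸ n)) (f n) + f n (suc N ∸ n)) + f (suc N) (suc N ∸ suc N)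
      ≈⟨ +-congʳ (∑-distrib-+ (suc N) _ _) ⟩
    ∑[ n < suc N ] ∑< (suc (N ∸ n)) (f n) + ∑[ n < suc N ] f n (suc N ∸ n) + f (suc N) (suc N ∸ suc N)
      ≈⟨ +-assoc _ _ _ ⟩
    ∑[ n < suc N ] ∑< (suc (N ∸ n)) (f n) + ∑[ n < suc (suc N) ] f n (suc N ∸ n)
      ≈⟨ +-congʳ (∑-triangle N f) ⟩
    ∑[ m < suc N ] ∑[ n < suc m ] f n (m ∸ n) + ∑[ n < suc (suc N) ] f n (suc N ∸ n)
      ∎
    where
    split-last : ∀ n → n < suc N → ∑< (suc (suc N ∸ n)) (f n) ≈ ∑< (suc (N ∸ n)) (f n) + f n (suc N ∸ n)
    split-last n (s≤s n≤N) rewrite ℕ.+-∸-assoc 1 n≤N = refl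
    last-row : ∑< (suc (suc N ∸ suc N)) (f (suc N)) ≈ f (suc N) (suc N ∸ suc N)
    last-row rewrite ℕ.n∸n≡0 N = +-identityˡ _

module FieldFacts {c ℓ : Level} (F : Field c ℓ) where
  open FieldOps F public hiding (zero)
  open IntegerCoefficientSolver commutativeRing public
  open Sums commutativeRing public
  open import Algebra.Properties.Semiring.Mult.TCOptimised semiring public using (_×_; 1+×)
  open import Relation.Binary.Reasoning.Setoid setoid public

  infix 4 _≉0
  _≉0 : Carrier → Set ℓ
  x ≉0 = ¬ (x ≈ 0#)

  x≈0⇒x*y≈0 : ∀ {x} y → x ≈ 0# → x * y ≈ 0#
  x≈0⇒x*y≈0 y x≈0 = trans (*-congʳ x≈0) (zeroˡ y)

  y≈0⇒x*y≈0 : ∀ x {y} → y ≈ 0# → x * y ≈ 0#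
  y≈0⇒x*y≈0 x y≈0 = trans (*-congˡ y≈0) (zeroʳ x)

  1≉0 : 1# ≉0
  1≉0 1≈0 = 0≉1 (sym 1≈0)

  ≉0-*ˡ : ∀ {x y} → x * y ≉0 → x ≉0
  ≉0-*ˡ {y = y} xy≉0 x≈0 = xy≉0 (x≈0⇒x*y≈0 y x≈0)

  ≉0-*ʳ : ∀ {x y} → x * y ≉0 → y ≉0
  ≉0-*ʳ {x = x} xy≉0 y≈0 = xy≉0 (y≈0⇒x*y≈0 x y≈0)

  ⁻¹-inverseˡ : ∀ {x} → x ≉0 → x ⁻¹ * x ≈ 1#
  ⁻¹-inverseˡ {x} x≉0 = trans (*-comm _ _) (inverseʳ x x≉0)

  *-≉0 : ∀ {x y} → x ≉0 → y ≉0 → x * y ≉0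
  *-≉0 {x} {y} x≉0 y≉0 xy≈0 = y≉0 (begin
    y              ≈⟨ *-identityˡ y ⟨
    1# * y         ≈⟨ *-congʳ (⁻¹-inverseˡ x≉0) ⟨
    x ⁻¹ * x * y   ≈⟨ *-assoc _ _ _ ⟩
    x ⁻¹ * (x * y) ≈⟨ y≈0⇒x*y≈0 _ xy≈0 ⟩
    0#             ∎)

  ^-≉0 : ∀ {x} n → x ≉0 → x ^ n ≉0
  ^-≉0 zero    x≉0 = 1≉0
  ^-≉0 (suc n) x≉0 = *-≉0 (^-≉0 n x≉0) x≉0

  *-cancelʳ : ∀ {x y d} → d ≉0 → x * d ≈ y * d → x ≈ y
  *-cancelʳ {x} {y} {d} d≉0 xd≈yd = begin
    x                ≈⟨ *-identityʳ x ⟨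
    x * 1#           ≈⟨ *-congˡ (inverseʳ d d≉0) ⟨
    x * (d * d ⁻¹)   ≈⟨ *-assoc x d _ ⟨
    x * d * d ⁻¹     ≈⟨ *-congʳ xd≈yd ⟩
    y * d * d ⁻¹     ≈⟨ *-assoc y d _ ⟩
    y * (d * d ⁻¹)   ≈⟨ *-congˡ (inverseʳ d d≉0) ⟩
    y * 1#           ≈⟨ *-identityʳ y ⟩
    y                ∎

  ⁻¹-unique : ∀ {x y} → x * y ≈ 1# → x ⁻¹ ≈ y
  ⁻¹-unique {x} {y} xy≈1 = *-cancelʳ x≉0 (trans (⁻¹-inverseˡ x≉0) (trans (sym xy≈1) (*-comm x y)))
    where
    x≉0 : x ≉0
    x≉0 x≈0 = 1≉0 (trans (sym xy≈1) (x≈0⇒x*y≈0 y x≈0))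

  ⁻¹-cong : ∀ {x y} → x ≈ y → y ≉0 → x ⁻¹ ≈ y ⁻¹
  ⁻¹-cong x≈y y≉0 = ⁻¹-unique (trans (*-congʳ x≈y) (inverseʳ _ y≉0))

  ⁻¹-distrib-* : ∀ {x y} → x ≉0 → y ≉0 → (x * y) ⁻¹ ≈ x ⁻¹ * y ⁻¹
  ⁻¹-distrib-* {x} {y} x≉0 y≉0 = ⁻¹-unique (begin
    x * y * (x ⁻¹ * y ⁻¹)        ≈⟨ solve 4 (λ x y u v → x :* y :* (u :* v) := (x :* u) :* (y :* v)) refl x y (x ⁻¹) (y ⁻¹) ⟩
    (x * x ⁻¹) * (y * y ⁻¹)      ≈⟨ *-cong (inverseʳ x x≉0) (inverseʳ y y≉0) ⟩
    1# * 1#                      ≈⟨ *-identityˡ 1# ⟩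
    1#                           ∎)

  ⁻¹-peel : ∀ {x y} → x * y ≉0 → x ⁻¹ ≈ y * (x * y) ⁻¹
  ⁻¹-peel {x} {y} xy≉0 = sym (begin
    y * (x * y) ⁻¹        ≈⟨ *-congˡ (⁻¹-distrib-* (≉0-*ˡ xy≉0) (≉0-*ʳ xy≉0)) ⟩
    y * (x ⁻¹ * y ⁻¹)     ≈⟨ solve 3 (λ y u v → y :* (u :* v) := u :* (y :* v)) refl y (x ⁻¹) (y ⁻¹) ⟩
    x ⁻¹ * (y * y ⁻¹)     ≈⟨ *-congˡ (inverseʳ y (≉0-*ʳ xy≉0)) ⟩
    x ⁻¹ * 1#             ≈⟨ *-identityʳ _ ⟩
    x ⁻¹                  ∎)

  1⁻¹≈1 : 1# ⁻¹ ≈ 1#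
  1⁻¹≈1 = ⁻¹-unique (*-identityˡ 1#)

  ^-cong : ∀ {x y} n → x ≈ y → x ^ n ≈ y ^ n
  ^-cong zero    x≈y = refl
  ^-cong (suc n) x≈y = *-cong (^-cong n x≈y) x≈y

  ^-homo-* : ∀ x m n → x ^ (m ℕ.+ n) ≈ x ^ m * x ^ n
  ^-homo-* x zero    n = sym (*-identityˡ _)
  ^-homo-* x (suc m) n = begin
    x ^ (m ℕ.+ n) * x    ≈⟨ *-congʳ (^-homo-* x m n) ⟩
    x ^ m * x ^ n * x    ≈⟨ solve 3 (λ a b c → a :* b :* c := a :* c :* b) refl (x ^ m) (x ^ n) x ⟩
    x ^ m * x * x ^ n    ∎

  ^-distrib-* : ∀ x y n → (x * y) ^ n ≈ x ^ n * y ^ n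
  ^-distrib-* x y zero    = sym (*-identityˡ 1#)
  ^-distrib-* x y (suc n) = begin
    (x * y) ^ n * (x * y)      ≈⟨ *-congʳ (^-distrib-* x y n) ⟩
    x ^ n * y ^ n * (x * y)    ≈⟨ solve 4 (λ a b c d → a :* b :* (c :* d) := a :* c :* (b :* d)) refl (x ^ n) (y ^ n) x y ⟩
    x ^ n * x * (y ^ n * y)    ∎

  ^-homo-∸ : ∀ x {i m} → i ≤ m → x ^ i * x ^ (m ∸ i) ≈ x ^ m
  ^-homo-∸ x {i} {m} i≤m = begin
    x ^ i * x ^ (m ∸ i)    ≈⟨ ^-homo-* x i (m ∸ i) ⟨
    x ^ (i ℕ.+ (m ∸ i))    ≡⟨ ≡.cong (x ^_) (ℕ.m+[n∸m]≡n i≤m) ⟩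
    x ^ m                  ∎

  1^n≈1 : ∀ n → 1# ^ n ≈ 1#
  1^n≈1 zero    = refl
  1^n≈1 (suc n) = trans (*-identityʳ _) (1^n≈1 n)

  ^-⁻¹ : ∀ {x} n → x ≉0 → (x ^ n) ⁻¹ ≈ (x ⁻¹) ^ n
  ^-⁻¹ {x} n x≉0 = ⁻¹-unique (begin
    x ^ n * (x ⁻¹) ^ n     ≈⟨ ^-distrib-* x (x ⁻¹) n ⟨
    (x * x ⁻¹) ^ n         ≈⟨ ^-cong n (inverseʳ x x≉0) ⟩
    1# ^ n                 ≈⟨ 1^n≈1 n ⟩
    1#                     ∎)

  sum1≈∑< : ∀ N f → sum1 N f ≈ ∑[ n < N ] f (suc n)
  sum1≈∑< zero    f = refl
  sum1≈∑< (suc N) f = +-congʳ (sum1≈∑< N f)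

  *-sum1 : ∀ N x (f g : ℕ → Carrier) → g 0 ≈ 0# → (∀ j → j < N → x * f (suc j) ≈ g (suc j)) →
           x * sum1 N f ≈ ∑< (suc N) g
  *-sum1 N x f g g0≈0 xf≈g = begin
    x * sum1 N f                     ≈⟨ *-congˡ (sum1≈∑< N f) ⟩
    x * ∑[ j < N ] f (suc j)         ≈⟨ *-distribˡ-∑ N x _ ⟩
    ∑[ j < N ] (x * f (suc j))       ≈⟨ ∑-cong N xf≈g ⟩
    ∑[ j < N ] g (suc j)             ≈⟨ +-identityˡ _ ⟨
    0# + ∑[ j < N ] g (suc j)        ≈⟨ +-congʳ g0≈0 ⟨
    g 0 + ∑[ j < N ] g (suc j)       ≈⟨ ∑-split-first N g ⟨
    ∑< (suc N) g                     ∎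

module QCalculus {c ℓ : Level} (F : Field c ℓ) (q : Field.Carrier F) where
  open FieldFacts F public

  qfac : ℕ → Carrier
  qfac = poch q q

  factor : Carrier → ℕ → Carrier
  factor x k = 1# - x * q ^ k

  qTri : ℕ → Carrier
  qTri zero    = 1#
  qTri (suc n) = qTri n * q ^ n

  qTri-+ : ∀ m n → qTri (m ℕ.+ n) ≈ qTri m * qTri n * (q ^ m) ^ n
  qTri-+ m zero rewrite ℕ.+-identityʳ m = sym (trans (*-identityʳ _) (*-identityʳ _))
  qTri-+ m (suc n) rewrite ℕ.+-suc m n = begin
    qTri (m ℕ.+ n) * q ^ (m ℕ.+ n)
      ≈⟨ *-cong (qTri-+ m n) (^-homo-* q m n) ⟩
    qTri m * qTri n * (q ^ m) ^ n * (q ^ m * q ^ n)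
      ≈⟨ solve 5 (λ a b c d e → a :* b :* c :* (d :* e) := a :* (b :* e) :* (c :* d))
         refl (qTri m) (qTri n) ((q ^ m) ^ n) (q ^ m) (q ^ n) ⟩
    qTri m * (qTri n * q ^ n) * ((q ^ m) ^ n * q ^ m)
      ∎

  qTri-pred : ∀ k → (1# - q ^ k) * (qTri (ℕ.pred k) * q ^ ℕ.pred k) ≈ (1# - q ^ k) * qTri k
  qTri-pred zero    = trans (x≈0⇒x*y≈0 _ (-‿inverseʳ 1#)) (sym (x≈0⇒x*y≈0 _ (-‿inverseʳ 1#)))
  qTri-pred (suc k) = refl

  qTri-double : ∀ n → q ^ (n ℕ.* suc n) ≈ qTri n * qTri n * (q ^ n * q ^ n)
  qTri-double zero    = solve 0 (𝟙 := 𝟙 :* 𝟙 :* (𝟙 :* 𝟙)) refl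
  qTri-double (suc n) = begin
    q ^ (suc n ℕ.* suc (suc n))
      ≡⟨ ≡.cong (q ^_) (exponent n) ⟩
    q ^ (n ℕ.* suc n ℕ.+ (suc n ℕ.+ suc n))
      ≈⟨ ^-homo-* q (n ℕ.* suc n) (suc n ℕ.+ suc n) ⟩
    q ^ (n ℕ.* suc n) * q ^ (suc n ℕ.+ suc n)
      ≈⟨ *-cong (qTri-double n) (^-homo-* q (suc n) (suc n)) ⟩
    qTri n * qTri n * (q ^ n * q ^ n) * (q ^ n * q * (q ^ n * q))
      ≈⟨ solve 3 (λ T Q q → T :* T :* (Q :* Q) :* (Q :* q :* (Q :* q)) := T :* Q :* (T :* Q) :* (Q :* q :* (Q :* q)))
         refl (qTri n) (q ^ n) q ⟩
    qTri (suc n) * qTri (suc n) * (q ^ suc n * q ^ suc n)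
      ∎
    where
    exponent : ∀ n → suc n ℕ.* suc (suc n) ≡ n ℕ.* suc n ℕ.+ (suc n ℕ.+ suc n)
    exponent = solve-∀
      where open import Data.Nat.Tactic.RingSolver

  poch-++ : ∀ x n k → poch q x (n ℕ.+ k) ≈ poch q x n * poch q (x * q ^ n) k
  poch-++ x n zero rewrite ℕ.+-identityʳ n = sym (*-identityʳ _)
  poch-++ x n (suc k) rewrite ℕ.+-suc n k = begin
    poch q x (n ℕ.+ k) * factor x (n ℕ.+ k)
      ≈⟨ *-cong (poch-++ x n k) (+-congˡ (-‿cong (*-congˡ (^-homo-* q n k)))) ⟩
    poch q x n * poch q (x * q ^ n) k * (1# - x * (q ^ n * q ^ k))
      ≈⟨ solve 5 (λ A B x u v → A :* B :* (𝟙 :- x :* (u :* v)) := A :* (B :* (𝟙 :- x :* u :* v)))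
         refl (poch q x n) (poch q (x * q ^ n) k) x (q ^ n) (q ^ k) ⟩
    poch q x n * (poch q (x * q ^ n) k * factor (x * q ^ n) k)
      ∎

  poch-split : ∀ x {n N} → n ≤ N → poch q x N ≈ poch q x n * poch q (x * q ^ n) (N ∸ n)
  poch-split x {n} {N} n≤N = begin
    poch q x N                                   ≡⟨ ≡.cong (poch q x) (ℕ.m+[n∸m]≡n n≤N) ⟨
    poch q x (n ℕ.+ (N ∸ n))                     ≈⟨ poch-++ x n (N ∸ n) ⟩
    poch q x n * poch q (x * q ^ n) (N ∸ n)      ∎

  poch-≉0-≤ : ∀ x {n N} → poch q x N ≉0 → n ≤ N → poch q x n ≉0
  poch-≉0-≤ x P≉0 n≤N Pn≈0 = P≉0 (trans (poch-split x n≤N) (x≈0⇒x*y≈0 _ Pn≈0))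

  factor-≉0 : ∀ x {k N} → poch q x N ≉0 → k < N → factor x k ≉0
  factor-≉0 x P≉0 k<N = ≉0-*ʳ (poch-≉0-≤ x P≉0 k<N)

  gauss : ℕ → ℕ → Carrier
  gauss m       zero    = 1#
  gauss zero    (suc n) = 0#
  gauss (suc m) (suc n) = q ^ suc n * gauss m (suc n) + gauss m n

  gauss-overflow : ∀ {m n} → m < n → gauss m n ≈ 0#
  gauss-overflow {zero}  {suc n} _         = refl
  gauss-overflow {suc m} {suc n} (s≤s m<n) = begin
    q ^ suc n * gauss m (suc n) + gauss m n  ≈⟨ +-cong (y≈0⇒x*y≈0 _ (gauss-overflow (ℕ.m<n⇒m<1+n m<n))) (gauss-overflow m<n) ⟩
    0# + 0#                                  ≈⟨ +-identityˡ 0# ⟩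
    0#                                       ∎

  gauss-ratio : ∀ m n → (1# - q ^ suc n) * gauss m (suc n) ≈ (1# - q ^ (m ∸ n)) * gauss m n
  gauss-ratio zero n rewrite ℕ.0∸n≡0 n =
    trans (zeroʳ _) (sym (x≈0⇒x*y≈0 _ (-‿inverseʳ 1#)))
  gauss-ratio (suc m) zero = begin
    (1# - q ^ 1) * (q ^ 1 * gauss m 1 + 1#)
      ≈⟨ solve 2 (λ q₁ X → (𝟙 :- q₁) :* (q₁ :* X :+ 𝟙) := q₁ :* ((𝟙 :- q₁) :* X) :+ (𝟙 :- q₁)) refl (q ^ 1) (gauss m 1) ⟩
    q ^ 1 * ((1# - q ^ 1) * gauss m 1) + (1# - q ^ 1)
      ≈⟨ +-congʳ (*-congˡ (gauss-ratio m zero)) ⟩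
    q ^ 1 * ((1# - q ^ m) * 1#) + (1# - q ^ 1)
      ≈⟨ solve 2 (λ q qm → (𝟙 :* q) :* ((𝟙 :- qm) :* 𝟙) :+ (𝟙 :- 𝟙 :* q) := (𝟙 :- qm :* q) :* 𝟙) refl q (q ^ m) ⟩
    (1# - q ^ m * q) * 1#
      ∎
  gauss-ratio (suc m) (suc n) = begin
    (1# - Q₂) * (Q₂ * X₂ + X)
      ≈⟨ solve 3 (λ Q₂ X₂ X → (𝟙 :- Q₂) :* (Q₂ :* X₂ :+ X) := Q₂ :* ((𝟙 :- Q₂) :* X₂) :+ (𝟙 :- Q₂) :* X) refl Q₂ X₂ X ⟩
    Q₂ * ((1# - Q₂) * X₂) + (1# - Q₂) * X
      ≈⟨ +-congʳ (*-congˡ (gauss-ratio m (suc n))) ⟩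
    Q₂ * ((1# - E₁) * X) + (1# - Q₂) * X
      ≈⟨ solve 3 (λ Q₂ E₁ X → Q₂ :* ((𝟙 :- E₁) :* X) :+ (𝟙 :- Q₂) :* X := X :- X :* (Q₂ :* E₁)) refl Q₂ E₁ X ⟩
    X - X * (Q₂ * E₁)
      ≈⟨ +-congˡ (-‿cong same-exponent) ⟩
    X - X * (Q₁ * E₀)
      ≈⟨ solve 3 (λ X Q₁ E₀ → X :- X :* (Q₁ :* E₀) := (𝟙 :- E₀) :* (Q₁ :* X) :+ (𝟙 :- Q₁) :* X) refl X Q₁ E₀ ⟩
    (1# - E₀) * (Q₁ * X) + (1# - Q₁) * X
      ≈⟨ +-congˡ (gauss-ratio m n) ⟩
    (1# - E₀) * (Q₁ * X) + (1# - E₀) * Y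
      ≈⟨ distribˡ _ _ _ ⟨
    (1# - E₀) * (Q₁ * X + Y)
      ∎
    where
    Q₂ Q₁ X₂ X Y E₁ E₀ : Carrier
    Q₂ = q ^ suc (suc n)
    Q₁ = q ^ suc n
    X₂ = gauss m (suc (suc n))
    X  = gauss m (suc n)
    Y  = gauss m n
    E₁ = q ^ (m ∸ suc n)
    E₀ = q ^ (m ∸ n)
    same-exponent : X * (Q₂ * E₁) ≈ X * (Q₁ * E₀)
    same-exponent with suc n ℕ.≤? m
    ... | yes n<m = *-congˡ (trans (^-homo-∸ q (s≤s n<m)) (sym (^-homo-∸ q (s≤s (ℕ.<⇒≤ n<m)))))
    ... | no  n≮m = trans (x≈0⇒x*y≈0 _ X≈0) (sym (x≈0⇒x*y≈0 _ X≈0))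
      where
      X≈0 : X ≈ 0#
      X≈0 = gauss-overflow (s≤s (ℕ.≮⇒≥ n≮m))

  gauss-qfac-step : ∀ m i → gauss m (suc i) * qfac (suc i) ≈ (1# - q ^ (m ∸ i)) * (gauss m i * qfac i)
  gauss-qfac-step m i = begin
    gauss m (suc i) * (qfac i * (1# - q * q ^ i))
      ≈⟨ solve 4 (λ X P q Q → X :* (P :* (𝟙 :- q :* Q)) := P :* ((𝟙 :- Q :* q) :* X)) refl (gauss m (suc i)) (qfac i) q (q ^ i) ⟩
    qfac i * ((1# - q ^ suc i) * gauss m (suc i))
      ≈⟨ *-congˡ (gauss-ratio m i) ⟩
    qfac i * ((1# - q ^ (m ∸ i)) * gauss m i)
      ≈⟨ solve 3 (λ P E Y → P :* ((𝟙 :- E) :* Y) := (𝟙 :- E) :* (Y :* P)) refl (qfac i) (q ^ (m ∸ i)) (gauss m i) ⟩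
    (1# - q ^ (m ∸ i)) * (gauss m i * qfac i)
      ∎

  gauss-pascal : ∀ m n → gauss (suc m) (suc n) ≈ gauss m (suc n) + q ^ (m ∸ n) * gauss m n
  gauss-pascal m n = begin
    Q * X + Y
      ≈⟨ solve 4 (λ Q X Y E → Q :* X :+ Y := X :+ E :* Y :+ ((𝟙 :- E) :* Y :- (𝟙 :- Q) :* X)) refl Q X Y E ⟩
    X + E * Y + ((1# - E) * Y - (1# - Q) * X)
      ≈⟨ +-congˡ (trans (+-congʳ (sym (gauss-ratio m n))) (-‿inverseʳ _)) ⟩
    X + E * Y + 0#
      ≈⟨ +-identityʳ _ ⟩
    X + E * Y
      ∎
    where
    Q X Y E : Carrier
    Q = q ^ suc n
    X = gauss m (suc n)
    Y = gauss m n
    E = q ^ (m ∸ n)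

  gauss-factorials : ∀ {m} n → n ≤ m → gauss m n * qfac n * qfac (m ∸ n) ≈ qfac m
  gauss-factorials {m} zero    _   = trans (*-congʳ (*-identityʳ 1#)) (*-identityˡ _)
  gauss-factorials {m} (suc n) n<m = begin
    gauss m (suc n) * (qfac n * (1# - q * q ^ n)) * qfac k
      ≈⟨ solve 5 (λ X P q Q R → X :* (P :* (𝟙 :- q :* Q)) :* R := (𝟙 :- Q :* q) :* X :* P :* R)
         refl (gauss m (suc n)) (qfac n) q (q ^ n) (qfac k) ⟩
    (1# - q ^ suc n) * gauss m (suc n) * qfac n * qfac k
      ≈⟨ *-congʳ (*-congʳ (gauss-ratio m n)) ⟩
    (1# - q ^ (m ∸ n)) * gauss m n * qfac n * qfac k
      ≈⟨ *-congʳ (*-congʳ (*-congʳ (+-congˡ (-‿cong (reflexive (≡.cong (q ^_) m∸n≡1+k)))))) ⟩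
    (1# - q ^ k * q) * gauss m n * qfac n * qfac k
      ≈⟨ solve 5 (λ E q X P R → (𝟙 :- E :* q) :* X :* P :* R := X :* P :* (R :* (𝟙 :- q :* E)))
         refl (q ^ k) q (gauss m n) (qfac n) (qfac k) ⟩
    gauss m n * qfac n * qfac (suc k)
      ≡⟨ ≡.cong (λ j → gauss m n * qfac n * qfac j) m∸n≡1+k ⟨
    gauss m n * qfac n * qfac (m ∸ n)
      ≈⟨ gauss-factorials n (ℕ.<⇒≤ n<m) ⟩
    qfac m
      ∎
    where
    k : ℕ
    k = m ∸ suc n
    m∸n≡1+k : m ∸ n ≡ suc k
    m∸n≡1+k = ℕ.+-∸-assoc 1 n<m

  gauss-product : ∀ {N n k} → qfac N ≉0 → n ≤ k → k ≤ N →
                  gauss N n * gauss (N ∸ n) (k ∸ n) ≈ gauss N k * gauss k n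
  gauss-product {N} {n} {k} qN≉0 n≤k k≤N = *-cancelʳ D≉0 (trans lhs (sym rhs))
    where
    D : Carrier
    D = qfac n * qfac (k ∸ n) * qfac (N ∸ k)
    D≉0 : D ≉0
    D≉0 = *-≉0 (*-≉0 (poch-≉0-≤ q qN≉0 (ℕ.≤-trans n≤k k≤N))
                     (poch-≉0-≤ q qN≉0 (ℕ.≤-trans (ℕ.m∸n≤m k n) k≤N)))
               (poch-≉0-≤ q qN≉0 (ℕ.m∸n≤m N k))
    N∸n∸[k∸n]≡N∸k : N ∸ n ∸ (k ∸ n) ≡ N ∸ k
    N∸n∸[k∸n]≡N∸k = ≡.trans (ℕ.∸-+-assoc N n (k ∸ n)) (≡.cong (N ∸_) (ℕ.m+[n∸m]≡n n≤k))
    lhs : gauss N n * gauss (N ∸ n) (k ∸ n) * D ≈ qfac N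
    lhs = begin
      gauss N n * gauss (N ∸ n) (k ∸ n) * (qfac n * qfac (k ∸ n) * qfac (N ∸ k))
        ≈⟨ solve 5 (λ a b c d e → a :* b :* (c :* d :* e) := a :* c :* (b :* d :* e))
           refl (gauss N n) (gauss (N ∸ n) (k ∸ n)) (qfac n) (qfac (k ∸ n)) (qfac (N ∸ k)) ⟩
      gauss N n * qfac n * (gauss (N ∸ n) (k ∸ n) * qfac (k ∸ n) * qfac (N ∸ k))
        ≡⟨ ≡.cong (λ j → gauss N n * qfac n * (gauss (N ∸ n) (k ∸ n) * qfac (k ∸ n) * qfac j)) N∸n∸[k∸n]≡N∸k ⟨
      gauss N n * qfac n * (gauss (N ∸ n) (k ∸ n) * qfac (k ∸ n) * qfac (N ∸ n ∸ (k ∸ n)))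
        ≈⟨ *-congˡ (gauss-factorials (k ∸ n) (ℕ.∸-monoˡ-≤ n k≤N)) ⟩
      gauss N n * qfac n * qfac (N ∸ n)
        ≈⟨ gauss-factorials n (ℕ.≤-trans n≤k k≤N) ⟩
      qfac N
        ∎
    rhs : gauss N k * gauss k n * D ≈ qfac N
    rhs = begin
      gauss N k * gauss k n * (qfac n * qfac (k ∸ n) * qfac (N ∸ k))
        ≈⟨ solve 5 (λ a b c d e → a :* b :* (c :* d :* e) := a :* (b :* c :* d) :* e)
           refl (gauss N k) (gauss k n) (qfac n) (qfac (k ∸ n)) (qfac (N ∸ k)) ⟩
      gauss N k * (gauss k n * qfac n * qfac (k ∸ n)) * qfac (N ∸ k)
        ≈⟨ *-congʳ (*-congˡ (gauss-factorials n n≤k)) ⟩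
      gauss N k * qfac k * qfac (N ∸ k)
        ≈⟨ gauss-factorials k k≤N ⟩
      qfac N
        ∎

  qbinom≈gauss : ∀ {N n} → qfac N ≉0 → n ≤ N → qbinom q N n ≈ gauss N n
  qbinom≈gauss {N} {n} qN≉0 n≤N with n ℕ.≤ᵇ N | ℕ.≤⇒≤ᵇ n≤N
  ... | true | _ = begin
    qfac N * D ⁻¹
      ≈⟨ *-congʳ (gauss-factorials n n≤N) ⟨
    gauss N n * qfac n * qfac (N ∸ n) * D ⁻¹
      ≈⟨ solve 4 (λ X P R I → X :* P :* R :* I := X :* (P :* R :* I)) refl (gauss N n) (qfac n) (qfac (N ∸ n)) (D ⁻¹) ⟩
    gauss N n * (D * D ⁻¹)
      ≈⟨ *-congˡ (inverseʳ D D≉0) ⟩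
    gauss N n * 1#
      ≈⟨ *-identityʳ _ ⟩
    gauss N n
      ∎
    where
    D : Carrier
    D = qfac n * qfac (N ∸ n)
    D≉0 : D ≉0
    D≉0 = *-≉0 (poch-≉0-≤ q qN≉0 n≤N) (poch-≉0-≤ q qN≉0 (ℕ.m∸n≤m N n))

  q-binomial-theorem : ∀ K x → poch q x K ≈ ∑[ j < suc K ] (gauss K j * ((- x) ^ j * qTri j))
  q-binomial-theorem zero    x = sym (trans (+-identityˡ _) (trans (*-identityˡ _) (*-identityˡ _)))
  q-binomial-theorem (suc K) x = sym (begin
    ∑< (suc (suc K)) h
      ≈⟨ ∑-split-first (suc K) h ⟩
    g 0 + ∑[ i < suc K ] h (suc i)
      ≈⟨ +-congˡ (∑-cong (suc K) pascal-step) ⟩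
    g 0 + ∑[ i < suc K ] (g (suc i) + κ * g i)
      ≈⟨ +-congˡ (∑-distrib-+ (suc K) _ _) ⟩
    g 0 + (∑[ i < suc K ] g (suc i) + ∑[ i < suc K ] (κ * g i))
      ≈⟨ +-assoc _ _ _ ⟨
    g 0 + ∑[ i < suc K ] g (suc i) + ∑[ i < suc K ] (κ * g i)
      ≈⟨ +-cong (∑-split-first (suc K) g) (*-distribˡ-∑ (suc K) κ g) ⟨
    ∑< (suc K) g + g (suc K) + κ * ∑< (suc K) g
      ≈⟨ +-congʳ (+-congˡ (x≈0⇒x*y≈0 _ (gauss-overflow {K} ℕ.≤-refl))) ⟩
    ∑< (suc K) g + 0# + κ * ∑< (suc K) g
      ≈⟨ +-cong (+-congʳ (q-binomial-theorem K x)) (*-congˡ (q-binomial-theorem K x)) ⟨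
    poch q x K + 0# + κ * poch q x K
      ≈⟨ solve 3 (λ P x Q → P :+ 𝟘 :+ (:- (x :* Q)) :* P := P :* (𝟙 :- x :* Q)) refl (poch q x K) x (q ^ K) ⟩
    poch q x K * factor x K
      ∎)
    where
    h g : ℕ → Carrier
    h j = gauss (suc K) j * ((- x) ^ j * qTri j)
    g j = gauss K j * ((- x) ^ j * qTri j)
    κ : Carrier
    κ = - (x * q ^ K)
    pascal-step : ∀ i → i < suc K → h (suc i) ≈ g (suc i) + κ * g i
    pascal-step i (s≤s i≤K) = begin
      gauss (suc K) (suc i) * ((- x) ^ i * - x * (qTri i * q ^ i))
        ≈⟨ *-congʳ (gauss-pascal K i) ⟩
      (gauss K (suc i) + q ^ (K ∸ i) * gauss K i) * ((- x) ^ i * - x * (qTri i * q ^ i))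
        ≈⟨ solve 7 (λ A E B P x T Q →
                      (A :+ E :* B) :* (P :* (:- x) :* (T :* Q))
                      := A :* (P :* (:- x) :* (T :* Q)) :+ (:- (x :* (Q :* E))) :* (B :* (P :* T)))
           refl (gauss K (suc i)) (q ^ (K ∸ i)) (gauss K i) ((- x) ^ i) x (qTri i) (q ^ i) ⟩
      g (suc i) + - (x * (q ^ i * q ^ (K ∸ i))) * g i
        ≈⟨ +-congˡ (*-congʳ (-‿cong (*-congˡ (^-homo-∸ q i≤K)))) ⟩
      g (suc i) + κ * g i
        ∎

  poch-resummation : ∀ N (U X : ℕ → Carrier) → qfac N ≉0 →
    ∑[ n < suc N ] (gauss N n * (U n * poch q (X n) (N ∸ n)))
      ≈ ∑[ m < suc N ] (gauss N m * ∑[ n < suc m ] (gauss m n * (U n * ((- X n) ^ (m ∸ n) * qTri (m ∸ n)))))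
  poch-resummation N U X qN≉0 = begin
    ∑[ n < suc N ] (gauss N n * (U n * poch q (X n) (N ∸ n)))
      ≈⟨ ∑-cong (suc N) (λ n _ → *-congˡ (*-congˡ (q-binomial-theorem (N ∸ n) (X n)))) ⟩
    ∑[ n < suc N ] (gauss N n * (U n * ∑[ j < suc (N ∸ n) ] (gauss (N ∸ n) j * T n j)))
      ≈⟨ ∑-cong (suc N) (λ n _ → distribute n) ⟩
    ∑[ n < suc N ] ∑< (suc (N ∸ n)) (f n)
      ≈⟨ ∑-triangle N f ⟩
    ∑[ m < suc N ] ∑[ n < suc m ] f n (m ∸ n)
      ≈⟨ ∑-cong (suc N) (λ m m≤N → trans (∑-cong (suc m) (λ n n≤m → regroup (ℕ.≤-pred m≤N) (ℕ.≤-pred n≤m)))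
                                          (sym (*-distribˡ-∑ (suc m) (gauss N m) _))) ⟩
    ∑[ m < suc N ] (gauss N m * ∑[ n < suc m ] (gauss m n * (U n * T n (m ∸ n))))
      ∎
    where
    T : ℕ → ℕ → Carrier
    T n j = (- X n) ^ j * qTri j
    f : ℕ → ℕ → Carrier
    f n j = gauss N n * (U n * (gauss (N ∸ n) j * T n j))
    distribute : ∀ n → gauss N n * (U n * ∑[ j < suc (N ∸ n) ] (gauss (N ∸ n) j * T n j)) ≈ ∑< (suc (N ∸ n)) (f n)
    distribute n = trans (*-congˡ (*-distribˡ-∑ (suc (N ∸ n)) (U n) _)) (*-distribˡ-∑ (suc (N ∸ n)) (gauss N n) _)
    regroup : ∀ {m n} → m ≤ N → n ≤ m → f n (m ∸ n) ≈ gauss N m * (gauss m n * (U n * T n (m ∸ n)))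
    regroup {m} {n} m≤N n≤m = begin
      gauss N n * (U n * (gauss (N ∸ n) (m ∸ n) * T n (m ∸ n)))
        ≈⟨ solve 4 (λ a u b t → a :* (u :* (b :* t)) := a :* b :* (u :* t))
           refl (gauss N n) (U n) (gauss (N ∸ n) (m ∸ n)) (T n (m ∸ n)) ⟩
      gauss N n * gauss (N ∸ n) (m ∸ n) * (U n * T n (m ∸ n))
        ≈⟨ *-congʳ (gauss-product qN≉0 n≤m m≤N) ⟩
      gauss N m * gauss m n * (U n * T n (m ∸ n))
        ≈⟨ *-assoc _ _ _ ⟩
      gauss N m * (gauss m n * (U n * T n (m ∸ n)))
        ∎

  logSum : Carrier → ℕ → Carrier
  logSum x N = ∑[ k < N ] (x * q ^ k * factor x k ⁻¹)

  q-binomial-theorem-derivative : ∀ N x → poch q x N ≉0 →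
    ∑[ m < suc N ] (gauss N m * (m × 1# * ((- x) ^ m * qTri m))) ≈ - (poch q x N * logSum x N)
  q-binomial-theorem-derivative zero    x _ = solve 0 (𝟘 :+ 𝟙 :* (𝟘 :* (𝟙 :* 𝟙)) := :- (𝟙 :* 𝟘)) refl
  q-binomial-theorem-derivative (suc N) x PN+1≉0 = begin
    R (suc N)
      ≈⟨ ∑-split-first (suc N) h ⟩
    h 0 + ∑[ i < suc N ] h (suc i)
      ≈⟨ +-cong (y≈0⇒x*y≈0 1# (zeroˡ _)) (∑-cong (suc N) pascal-step) ⟩
    0# + ∑[ i < suc N ] (g (suc i) + κ * (g i + k i))
      ≈⟨ trans (+-identityˡ _) (∑-distrib-+ (suc N) _ _) ⟩
    ∑[ i < suc N ] g (suc i) + ∑[ i < suc N ] (κ * (g i + k i))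
      ≈⟨ +-cong (∑-shift N g (y≈0⇒x*y≈0 1# (zeroˡ _)) (x≈0⇒x*y≈0 _ (gauss-overflow {N} ℕ.≤-refl))) (sym (*-distribˡ-∑ (suc N) κ _)) ⟩
    R N + κ * ∑[ i < suc N ] (g i + k i)
      ≈⟨ +-congˡ (*-congˡ (∑-distrib-+ (suc N) g k)) ⟩
    R N + κ * (R N + ∑< (suc N) k)
      ≈⟨ +-cong RN≈-PL (*-congˡ (+-cong RN≈-PL (sym (q-binomial-theorem N x)))) ⟩
    - (P * L) + κ * (- (P * L) + P)
      ≈⟨ solve 4 (λ P L x Q →
                    :- (P :* L) :+ (:- (x :* Q)) :* (:- (P :* L) :+ P)
                    := :- (P :* (𝟙 :- x :* Q) :* L :+ P :* x :* Q :* 𝟙))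
         refl P L x (q ^ N) ⟩
    - (P * d * L + P * x * q ^ N * 1#)
      ≈⟨ -‿cong (+-congˡ (*-congˡ (inverseʳ d (≉0-*ʳ PN+1≉0)))) ⟨
    - (P * d * L + P * x * q ^ N * (d * d ⁻¹))
      ≈⟨ -‿cong (solve 6 (λ P c L x Q i → P :* c :* L :+ P :* x :* Q :* (c :* i) := P :* c :* (L :+ x :* Q :* i))
         refl P d L x (q ^ N) (d ⁻¹)) ⟩
    - (P * d * (L + x * q ^ N * d ⁻¹))
      ∎
    where
    P L d κ : Carrier
    P = poch q x N
    L = logSum x N
    d = factor x N
    κ = - (x * q ^ N)
    R : ℕ → Carrier
    R K = ∑[ m < suc K ] (gauss K m * (m × 1# * ((- x) ^ m * qTri m)))
    RN≈-PL : R N ≈ - (P * L)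
    RN≈-PL = q-binomial-theorem-derivative N x (≉0-*ˡ PN+1≉0)
    h g k : ℕ → Carrier
    h m = gauss (suc N) m * (m × 1# * ((- x) ^ m * qTri m))
    g m = gauss N m * (m × 1# * ((- x) ^ m * qTri m))
    k m = gauss N m * ((- x) ^ m * qTri m)
    pascal-step : ∀ i → i < suc N → h (suc i) ≈ g (suc i) + κ * (g i + k i)
    pascal-step i (s≤s i≤N) = begin
      gauss (suc N) (suc i) * (suc i × 1# * W)
        ≈⟨ *-cong (gauss-pascal N i) (*-congʳ (1+× i 1#)) ⟩
      (gauss N (suc i) + q ^ (N ∸ i) * gauss N i) * ((1# + i × 1#) * W)
        ≈⟨ solve 8 (λ A E B I X x T Q →
                      (A :+ E :* B) :* ((𝟙 :+ I) :* (X :* (:- x) :* (T :* Q)))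
                      := A :* ((𝟙 :+ I) :* (X :* (:- x) :* (T :* Q))) :+ (:- (x :* (Q :* E))) :* (B :* (I :* (X :* T)) :+ B :* (X :* T)))
           refl (gauss N (suc i)) (q ^ (N ∸ i)) (gauss N i) (i × 1#) ((- x) ^ i) x (qTri i) (q ^ i) ⟩
      gauss N (suc i) * ((1# + i × 1#) * W) + - (x * (q ^ i * q ^ (N ∸ i))) * (g i + k i)
        ≈⟨ +-cong (*-congˡ (*-congʳ (1+× i 1#))) (*-congʳ (-‿cong (*-congˡ (sym (^-homo-∸ q i≤N))))) ⟨
      g (suc i) + κ * (g i + k i)
        ∎
      where
      W : Carrier
      W = (- x) ^ i * - x * (qTri i * q ^ i)

module InnerSums {c ℓ : Level} (F : Field c ℓ) (q a : Field.Carrier F) where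
  open QCalculus F q public

  weight : ℕ → Carrier
  weight zero    = 0#
  weight (suc j) = qfac j * poch q a (suc j) ⁻¹

  recipSum : ℕ → Carrier
  recipSum m = ∑[ k < m ] (factor a k ⁻¹)

  ∑-weight-qTri-telescope : ∀ m → poch q a (suc m) ≉0 →
    ∑[ i < suc m ] (q ^ (m ∸ i) * gauss m i * (weight (suc i) * ((- a) ^ suc i * qTri (suc i))))
      ≈ - (a * q ^ m * factor a m ⁻¹)
  ∑-weight-qTri-telescope m Pm+1≉0 = begin
    ∑[ i < suc m ] (q ^ (m ∸ i) * gauss m i * (weight (suc i) * ((- a) ^ suc i * qTri (suc i))))
      ≈⟨ ∑-cong (suc m) term ⟩
    ∑[ i < suc m ] (κ * t i)
      ≈⟨ *-distribˡ-∑ (suc m) κ t ⟨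
    κ * ∑< (suc m) t
      ≈⟨ *-congˡ (∑-telescope (suc m) t u step) ⟩
    κ * (u 0 - u (suc m))
      ≈⟨ *-congˡ (+-cong u0≈d⁻¹ (-‿cong um+1≈0)) ⟩
    κ * (d ⁻¹ - 0#)
      ≈⟨ solve 3 (λ a Q i → (:- (a :* Q)) :* (i :- 𝟘) := :- (a :* Q :* i)) refl a (q ^ m) (d ⁻¹) ⟩
    - (a * q ^ m * d ⁻¹)
      ∎
    where
    d κ : Carrier
    d = factor a m
    κ = - (a * q ^ m)
    t u : ℕ → Carrier
    t i = gauss m i * qfac i * (- a) ^ i * qTri i * poch q a (suc i) ⁻¹
    u i = gauss m i * qfac i * (- a) ^ i * qTri i * poch q a i ⁻¹ * d ⁻¹
    term : ∀ i → i < suc m → q ^ (m ∸ i) * gauss m i * (weight (suc i) * ((- a) ^ suc i * qTri (suc i))) ≈ κ * t i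
    term i (s≤s i≤m) = begin
      q ^ (m ∸ i) * gauss m i * (qfac i * poch q a (suc i) ⁻¹ * ((- a) ^ i * - a * (qTri i * q ^ i)))
        ≈⟨ solve 8 (λ E X P W A a T Q →
                      E :* X :* (P :* W :* (A :* (:- a) :* (T :* Q)))
                      := (:- (a :* (Q :* E))) :* (X :* P :* A :* T :* W))
           refl (q ^ (m ∸ i)) (gauss m i) (qfac i) (poch q a (suc i) ⁻¹) ((- a) ^ i) a (qTri i) (q ^ i) ⟩
      - (a * (q ^ i * q ^ (m ∸ i))) * t i
        ≈⟨ *-congʳ (-‿cong (*-congˡ (^-homo-∸ q i≤m))) ⟩
      κ * t i
        ∎
    step : ∀ i → i < suc m → t i ≈ u i - u (suc i)
    step i (s≤s i≤m) = sym (begin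
      X * P * A * T * W₀ * d ⁻¹ - gauss m (suc i) * qfac (suc i) * (A * - a) * (T * Q) * W₁ * d ⁻¹
        ≈⟨ +-cong (*-congʳ (*-congˡ (⁻¹-peel Pi+1≉0))) (-‿cong (*-congʳ (*-congʳ (*-congʳ (*-congʳ (gauss-qfac-step m i)))))) ⟩
      X * P * A * T * (factor a i * W₁) * d ⁻¹ - (1# - E) * (X * P) * (A * - a) * (T * Q) * W₁ * d ⁻¹
        ≈⟨ solve 9 (λ X P A T a Q W₁ i E →
                      X :* P :* A :* T :* ((𝟙 :- a :* Q) :* W₁) :* i :- (𝟙 :- E) :* (X :* P) :* (A :* (:- a)) :* (T :* Q) :* W₁ :* i
                      := X :* P :* A :* T :* W₁ :* ((𝟙 :- a :* (Q :* E)) :* i))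
           refl X P A T a Q W₁ (d ⁻¹) E ⟩
      X * P * A * T * W₁ * ((1# - a * (Q * E)) * d ⁻¹)
        ≈⟨ *-congˡ (trans (*-congʳ (+-congˡ (-‿cong (*-congˡ (^-homo-∸ q i≤m))))) (inverseʳ d d≉0)) ⟩
      X * P * A * T * W₁ * 1#
        ≈⟨ *-identityʳ _ ⟩
      t i
        ∎)
      where
      X P A T Q E W₀ W₁ : Carrier
      X  = gauss m i
      P  = qfac i
      A  = (- a) ^ i
      T  = qTri i
      Q  = q ^ i
      E  = q ^ (m ∸ i)
      W₀ = poch q a i ⁻¹
      W₁ = poch q a (suc i) ⁻¹
      Pi+1≉0 : poch q a (suc i) ≉0
      Pi+1≉0 = poch-≉0-≤ a Pm+1≉0 (s≤s i≤m)
      d≉0 : d ≉0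
      d≉0 = ≉0-*ʳ Pm+1≉0
    u0≈d⁻¹ : u 0 ≈ d ⁻¹
    u0≈d⁻¹ = trans (*-congʳ (*-congˡ 1⁻¹≈1)) (solve 1 (λ i → 𝟙 :* 𝟙 :* 𝟙 :* 𝟙 :* 𝟙 :* i := i) refl (d ⁻¹))
    um+1≈0 : u (suc m) ≈ 0#
    um+1≈0 = x≈0⇒x*y≈0 _ (x≈0⇒x*y≈0 _ (x≈0⇒x*y≈0 _ (x≈0⇒x*y≈0 _ (x≈0⇒x*y≈0 _ (gauss-overflow {m} ℕ.≤-refl)))))

  ∑-weight-qTri : ∀ m → poch q a m ≉0 →
    ∑[ n < suc m ] (gauss m n * (weight n * ((- a) ^ n * qTri n))) ≈ - logSum a m
  ∑-weight-qTri zero    _       = solve 0 (𝟘 :+ 𝟙 :* (𝟘 :* (𝟙 :* 𝟙)) := :- 𝟘) refl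
  ∑-weight-qTri (suc m) Pm+1≉0 = begin
    ∑< (suc (suc m)) h
      ≈⟨ ∑-split-first (suc m) h ⟩
    h 0 + ∑[ i < suc m ] h (suc i)
      ≈⟨ +-cong (y≈0⇒x*y≈0 1# (zeroˡ _)) (∑-cong (suc m) (λ i _ → trans (*-congʳ (gauss-pascal m i)) (distribʳ _ _ _))) ⟩
    0# + ∑[ i < suc m ] (g (suc i) + q ^ (m ∸ i) * gauss m i * S (suc i))
      ≈⟨ trans (+-identityˡ _) (∑-distrib-+ (suc m) _ _) ⟩
    ∑[ i < suc m ] g (suc i) + ∑[ i < suc m ] (q ^ (m ∸ i) * gauss m i * S (suc i))
      ≈⟨ +-cong (∑-shift m g (y≈0⇒x*y≈0 1# (zeroˡ _)) (x≈0⇒x*y≈0 _ (gauss-overflow {m} ℕ.≤-refl)))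
                (∑-weight-qTri-telescope m Pm+1≉0) ⟩
    ∑< (suc m) g + - (a * q ^ m * factor a m ⁻¹)
      ≈⟨ +-congʳ (∑-weight-qTri m (≉0-*ˡ Pm+1≉0)) ⟩
    - logSum a m + - (a * q ^ m * factor a m ⁻¹)
      ≈⟨ solve 2 (λ x y → :- x :+ :- y := :- (x :+ y)) refl (logSum a m) (a * q ^ m * factor a m ⁻¹) ⟩
    - logSum a (suc m)
      ∎
    where
    S g h : ℕ → Carrier
    S n = weight n * ((- a) ^ n * qTri n)
    g n = gauss m n * S n
    h n = gauss (suc m) n * S n

  ∑-weight-qTri-complement-telescope : ∀ m → poch q a (suc m) ≉0 →
    ∑[ i < suc m ] (gauss m i * (weight (suc i) * ((- 1#) ^ suc i * qTri (m ∸ i))))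
      ≈ - (qTri m * q ^ m * factor a m ⁻¹)
  ∑-weight-qTri-complement-telescope m Pm+1≉0 = begin
    ∑[ i < suc m ] (gauss m i * (weight (suc i) * ((- 1#) ^ suc i * qTri (m ∸ i))))
      ≈⟨ ∑-cong (suc m) term ⟩
    ∑[ i < suc m ] (- t i)
      ≈⟨ ∑-neg (suc m) t ⟩
    - ∑< (suc m) t
      ≈⟨ -‿cong (∑-telescope (suc m) t u step) ⟩
    - (u 0 - u (suc m))
      ≈⟨ -‿cong (+-cong u0≈ (-‿cong um+1≈0)) ⟩
    - (qTri m * q ^ m * d ⁻¹ - 0#)
      ≈⟨ solve 1 (λ x → :- (x :- 𝟘) := :- x) refl (qTri m * q ^ m * d ⁻¹) ⟩
    - (qTri m * q ^ m * d ⁻¹)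
      ∎
    where
    d : Carrier
    d = factor a m
    t u : ℕ → Carrier
    t i = gauss m i * qfac i * (- 1#) ^ i * qTri (m ∸ i) * poch q a (suc i) ⁻¹
    u i = gauss m i * qfac i * (- 1#) ^ i * (qTri (m ∸ i) * q ^ (m ∸ i)) * poch q a i ⁻¹ * d ⁻¹
    term : ∀ i → i < suc m → gauss m i * (weight (suc i) * ((- 1#) ^ suc i * qTri (m ∸ i))) ≈ - t i
    term i _ = solve 5 (λ X P W S T → X :* (P :* W :* (S :* (:- 𝟙) :* T)) := :- (X :* P :* S :* T :* W)) refl
                 (gauss m i) (qfac i) (poch q a (suc i) ⁻¹) ((- 1#) ^ i) (qTri (m ∸ i))
    step : ∀ i → i < suc m → t i ≈ u i - u (suc i)
    step i (s≤s i≤m) = sym (begin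
      X * P * S * (T * E) * W₀ * d ⁻¹ - gauss m (suc i) * qfac (suc i) * (S * - 1#) * (T′ * E′) * W₁ * d ⁻¹
        ≈⟨ +-cong (*-congʳ (*-congˡ (⁻¹-peel Pi+1≉0))) (-‿cong (*-congʳ (*-congʳ (*-congʳ (*-congʳ (gauss-qfac-step m i)))))) ⟩
      X * P * S * (T * E) * (factor a i * W₁) * d ⁻¹ - (1# - E) * (X * P) * (S * - 1#) * (T′ * E′) * W₁ * d ⁻¹
        ≈⟨ +-congˡ (-‿cong (solve 8 (λ E X P S T′ E′ W i →
                                       (𝟙 :- E) :* (X :* P) :* (S :* (:- 𝟙)) :* (T′ :* E′) :* W :* i
                                       := (𝟙 :- E) :* (T′ :* E′) :* (X :* P :* S :* (:- 𝟙) :* W :* i))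
           refl E X P S T′ E′ W₁ (d ⁻¹))) ⟩
      X * P * S * (T * E) * (factor a i * W₁) * d ⁻¹ - (1# - E) * (T′ * E′) * (X * P * S * - 1# * W₁ * d ⁻¹)
        ≈⟨ +-congˡ (-‿cong (*-congʳ qTri-step)) ⟩
      X * P * S * (T * E) * (factor a i * W₁) * d ⁻¹ - (1# - E) * T * (X * P * S * - 1# * W₁ * d ⁻¹)
        ≈⟨ solve 9 (λ X P S T E a Q W i →
                      X :* P :* S :* (T :* E) :* ((𝟙 :- a :* Q) :* W) :* i :- (𝟙 :- E) :* T :* (X :* P :* S :* (:- 𝟙) :* W :* i)
                      := X :* P :* S :* T :* W :* ((𝟙 :- a :* (Q :* E)) :* i))
           refl X P S T E a Q W₁ (d ⁻¹) ⟩
      X * P * S * T * W₁ * ((1# - a * (Q * E)) * d ⁻¹)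
        ≈⟨ *-congˡ (trans (*-congʳ (+-congˡ (-‿cong (*-congˡ (^-homo-∸ q i≤m))))) (inverseʳ d d≉0)) ⟩
      X * P * S * T * W₁ * 1#
        ≈⟨ *-identityʳ _ ⟩
      t i
        ∎)
      where
      X P S T T′ Q E E′ W₀ W₁ : Carrier
      X  = gauss m i
      P  = qfac i
      S  = (- 1#) ^ i
      T  = qTri (m ∸ i)
      T′ = qTri (m ∸ suc i)
      Q  = q ^ i
      E  = q ^ (m ∸ i)
      E′ = q ^ (m ∸ suc i)
      W₀ = poch q a i ⁻¹
      W₁ = poch q a (suc i) ⁻¹
      qTri-step : (1# - E) * (T′ * E′) ≈ (1# - E) * T
      qTri-step rewrite ≡.sym (ℕ.pred[m∸n]≡m∸[1+n] m i) = qTri-pred (m ∸ i)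
      Pi+1≉0 : poch q a (suc i) ≉0
      Pi+1≉0 = poch-≉0-≤ a Pm+1≉0 (s≤s i≤m)
      d≉0 : d ≉0
      d≉0 = ≉0-*ʳ Pm+1≉0
    u0≈ : u 0 ≈ qTri m * q ^ m * d ⁻¹
    u0≈ = trans (*-congʳ (*-congˡ 1⁻¹≈1)) (solve 3 (λ T E i → 𝟙 :* 𝟙 :* 𝟙 :* (T :* E) :* 𝟙 :* i := T :* E :* i)
       refl (qTri m) (q ^ m) (d ⁻¹))
    um+1≈0 : u (suc m) ≈ 0#
    um+1≈0 = x≈0⇒x*y≈0 _ (x≈0⇒x*y≈0 _ (x≈0⇒x*y≈0 _ (x≈0⇒x*y≈0 _ (x≈0⇒x*y≈0 _ (gauss-overflow {m} ℕ.≤-refl)))))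

  ∑-weight-qTri-complement : ∀ m → poch q a m ≉0 →
    ∑[ n < suc m ] (gauss m n * (weight n * ((- 1#) ^ n * qTri (m ∸ n)))) ≈ - (qTri m * recipSum m)
  ∑-weight-qTri-complement zero    _       = solve 0 (𝟘 :+ 𝟙 :* (𝟘 :* (𝟙 :* 𝟙)) := :- (𝟙 :* 𝟘)) refl
  ∑-weight-qTri-complement (suc m) Pm+1≉0 = begin
    ∑< (suc (suc m)) h
      ≈⟨ ∑-split-first (suc m) h ⟩
    h 0 + ∑[ i < suc m ] h (suc i)
      ≈⟨ +-cong (y≈0⇒x*y≈0 1# (zeroˡ _)) (∑-cong (suc m) (λ i _ → distribʳ _ _ _)) ⟩
    0# + ∑[ i < suc m ] (q ^ suc i * gauss m (suc i) * V i + gauss m i * V i)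
      ≈⟨ trans (+-identityˡ _) (∑-distrib-+ (suc m) _ _) ⟩
    ∑[ i < suc m ] (q ^ suc i * gauss m (suc i) * V i) + ∑[ i < suc m ] (gauss m i * V i)
      ≈⟨ +-cong (∑-cong (suc m) rescale) (∑-weight-qTri-complement-telescope m Pm+1≉0) ⟩
    ∑[ i < suc m ] (q ^ m * g (suc i)) + - (qTri m * q ^ m * d ⁻¹)
      ≈⟨ +-congʳ (*-distribˡ-∑ (suc m) (q ^ m) _) ⟨
    q ^ m * ∑[ i < suc m ] g (suc i) + - (qTri m * q ^ m * d ⁻¹)
      ≈⟨ +-congʳ (*-congˡ (∑-shift m g (y≈0⇒x*y≈0 1# (zeroˡ _)) (x≈0⇒x*y≈0 _ (gauss-overflow {m} ℕ.≤-refl)))) ⟩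
    q ^ m * ∑< (suc m) g + - (qTri m * q ^ m * d ⁻¹)
      ≈⟨ +-congʳ (*-congˡ (∑-weight-qTri-complement m (≉0-*ˡ Pm+1≉0))) ⟩
    q ^ m * - (qTri m * recipSum m) + - (qTri m * q ^ m * d ⁻¹)
      ≈⟨ solve 4 (λ Q T B i → Q :* (:- (T :* B)) :+ (:- (T :* Q :* i)) := :- (T :* Q :* (B :+ i)))
         refl (q ^ m) (qTri m) (recipSum m) (d ⁻¹) ⟩
    - (qTri (suc m) * recipSum (suc m))
      ∎
    where
    d : Carrier
    d = factor a m
    V g h : ℕ → Carrier
    V i = weight (suc i) * ((- 1#) ^ suc i * qTri (m ∸ i))
    g n = gauss m n * (weight n * ((- 1#) ^ n * qTri (m ∸ n)))
    h n = gauss (suc m) n * (weight n * ((- 1#) ^ n * qTri (suc m ∸ n)))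
    rescale : ∀ i → i < suc m → q ^ suc i * gauss m (suc i) * V i ≈ q ^ m * g (suc i)
    rescale i _ with suc i ℕ.≤? m
    ... | yes i<m = begin
      q ^ suc i * gauss m (suc i) * (weight (suc i) * ((- 1#) ^ suc i * qTri (m ∸ i)))
        ≡⟨ ≡.cong (λ j → q ^ suc i * gauss m (suc i) * (weight (suc i) * ((- 1#) ^ suc i * qTri j))) (ℕ.+-∸-assoc 1 i<m) ⟩
      q ^ suc i * gauss m (suc i) * (weight (suc i) * ((- 1#) ^ suc i * (qTri (m ∸ suc i) * q ^ (m ∸ suc i))))
        ≈⟨ solve 6 (λ Q X W S T E → Q :* X :* (W :* (S :* (T :* E))) := Q :* E :* (X :* (W :* (S :* T))))
           refl (q ^ suc i) (gauss m (suc i)) (weight (suc i)) ((- 1#) ^ suc i) (qTri (m ∸ suc i)) (q ^ (m ∸ suc i)) ⟩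
      q ^ suc i * q ^ (m ∸ suc i) * g (suc i)
        ≈⟨ *-congʳ (^-homo-∸ q i<m) ⟩
      q ^ m * g (suc i)
        ∎
    ... | no  i≮m = trans (x≈0⇒x*y≈0 _ (y≈0⇒x*y≈0 _ X≈0)) (sym (y≈0⇒x*y≈0 _ (x≈0⇒x*y≈0 _ X≈0)))
      where
      X≈0 : gauss m (suc i) ≈ 0#
      X≈0 = gauss-overflow (s≤s (ℕ.≮⇒≥ i≮m))

module ClearedIdentity {c ℓ : Level} (F : Field c ℓ) (q a b : Field.Carrier F) where
  open InnerSums F q a public

  recipSum≈logSum+m : ∀ m → poch q a m ≉0 → recipSum m ≈ logSum a m + m × 1#
  recipSum≈logSum+m zero    _       = sym (+-identityʳ 0#)
  recipSum≈logSum+m (suc m) Pm+1≉0 = begin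
    recipSum m + d ⁻¹
      ≈⟨ +-congʳ (recipSum≈logSum+m m (≉0-*ˡ Pm+1≉0)) ⟩
    logSum a m + m × 1# + d ⁻¹
      ≈⟨ solve 5 (λ L M a Q i → L :+ M :+ i := L :+ a :* Q :* i :+ ((𝟙 :- a :* Q) :* i :+ M))
         refl (logSum a m) (m × 1#) a (q ^ m) (d ⁻¹) ⟩
    logSum a (suc m) + (d * d ⁻¹ + m × 1#)
      ≈⟨ +-congˡ (+-congʳ (inverseʳ d (≉0-*ʳ Pm+1≉0))) ⟩
    logSum a (suc m) + (1# + m × 1#)
      ≈⟨ +-congˡ (1+× m 1#) ⟨
    logSum a (suc m) + suc m × 1#
      ∎
    where
    d : Carrier
    d = factor a m

  U V : ℕ → Carrier
  U n = weight n * (b ^ n * a ^ n * (qTri n * qTri n))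
  V n = weight n * b ^ n

  inner-U : ∀ m → poch q a m ≉0 →
    ∑[ n < suc m ] (gauss m n * (U n * ((- (b * q ^ n)) ^ (m ∸ n) * qTri (m ∸ n)))) ≈ (- b) ^ m * qTri m * - logSum a m
  inner-U m Pm≉0 = begin
    ∑[ n < suc m ] (gauss m n * (U n * ((- (b * q ^ n)) ^ (m ∸ n) * qTri (m ∸ n))))
      ≈⟨ ∑-cong (suc m) (λ n n<1+m → *-congˡ (pointwise (ℕ.≤-pred n<1+m))) ⟩
    ∑[ n < suc m ] (gauss m n * ((- b) ^ m * qTri m * (weight n * ((- a) ^ n * qTri n))))
      ≈⟨ ∑-cong (suc m) (λ n _ → solve 3 (λ X C Y → X :* (C :* Y) := C :* (X :* Y)) refl (gauss m n) ((- b) ^ m * qTri m) _) ⟩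
    ∑[ n < suc m ] ((- b) ^ m * qTri m * (gauss m n * (weight n * ((- a) ^ n * qTri n))))
      ≈⟨ *-distribˡ-∑ (suc m) _ _ ⟨
    (- b) ^ m * qTri m * ∑[ n < suc m ] (gauss m n * (weight n * ((- a) ^ n * qTri n)))
      ≈⟨ *-congˡ (∑-weight-qTri m Pm≉0) ⟩
    (- b) ^ m * qTri m * - logSum a m
      ∎
    where
    pointwise : ∀ {n} → n ≤ m → U n * ((- (b * q ^ n)) ^ (m ∸ n) * qTri (m ∸ n)) ≈ (- b) ^ m * qTri m * (weight n * ((- a) ^ n * qTri n))
    pointwise {n} n≤m = begin
      weight n * (b ^ n * a ^ n * (qTri n * qTri n)) * ((- (b * q ^ n)) ^ k * qTri k)
        ≈⟨ *-congˡ (*-congʳ (trans (^-cong k (solve 2 (λ b Q → :- (b :* Q) := (:- b) :* Q)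
           refl b (q ^ n))) (^-distrib-* (- b) (q ^ n) k))) ⟩
      weight n * (b ^ n * a ^ n * (qTri n * qTri n)) * ((- b) ^ k * (q ^ n) ^ k * qTri k)
        ≈⟨ *-congʳ (*-congˡ (*-congʳ negate-both)) ⟩
      weight n * ((- b) ^ n * (- a) ^ n * (qTri n * qTri n)) * ((- b) ^ k * (q ^ n) ^ k * qTri k)
        ≈⟨ solve 7 (λ W B A T B′ Q T′ →
                      W :* (B :* A :* (T :* T)) :* (B′ :* Q :* T′)
                      := B :* B′ :* (T :* T′ :* Q) :* (W :* (A :* T)))
           refl (weight n) ((- b) ^ n) ((- a) ^ n) (qTri n) ((- b) ^ k) ((q ^ n) ^ k) (qTri k) ⟩
      (- b) ^ n * (- b) ^ k * (qTri n * qTri k * (q ^ n) ^ k) * (weight n * ((- a) ^ n * qTri n))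
        ≈⟨ *-congʳ (*-cong (^-homo-∸ (- b) n≤m) (trans (sym (qTri-+ n k)) ≡-qTri)) ⟩
      (- b) ^ m * qTri m * (weight n * ((- a) ^ n * qTri n))
        ∎
      where
      k : ℕ
      k = m ∸ n
      ≡-qTri : qTri (n ℕ.+ k) ≈ qTri m
      ≡-qTri = reflexive (≡.cong qTri (ℕ.m+[n∸m]≡n n≤m))
      negate-both : b ^ n * a ^ n ≈ (- b) ^ n * (- a) ^ n
      negate-both = begin
        b ^ n * a ^ n            ≈⟨ ^-distrib-* b a n ⟨
        (b * a) ^ n              ≈⟨ ^-cong n (solve 2 (λ b a → b :* a := (:- b) :* (:- a)) refl b a) ⟩
        ((- b) * (- a)) ^ n      ≈⟨ ^-distrib-* (- b) (- a) n ⟩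
        (- b) ^ n * (- a) ^ n    ∎

  inner-V : ∀ m → poch q a m ≉0 →
    ∑[ n < suc m ] (gauss m n * (V n * ((- b) ^ (m ∸ n) * qTri (m ∸ n)))) ≈ (- b) ^ m * - (qTri m * recipSum m)
  inner-V m Pm≉0 = begin
    ∑[ n < suc m ] (gauss m n * (V n * ((- b) ^ (m ∸ n) * qTri (m ∸ n))))
      ≈⟨ ∑-cong (suc m) (λ n n<1+m → *-congˡ (pointwise (ℕ.≤-pred n<1+m))) ⟩
    ∑[ n < suc m ] (gauss m n * ((- b) ^ m * (weight n * ((- 1#) ^ n * qTri (m ∸ n)))))
      ≈⟨ ∑-cong (suc m) (λ n _ → solve 3 (λ X C Y → X :* (C :* Y) := C :* (X :* Y)) refl (gauss m n) ((- b) ^ m) _) ⟩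
    ∑[ n < suc m ] ((- b) ^ m * (gauss m n * (weight n * ((- 1#) ^ n * qTri (m ∸ n)))))
      ≈⟨ *-distribˡ-∑ (suc m) _ _ ⟨
    (- b) ^ m * ∑[ n < suc m ] (gauss m n * (weight n * ((- 1#) ^ n * qTri (m ∸ n))))
      ≈⟨ *-congˡ (∑-weight-qTri-complement m Pm≉0) ⟩
    (- b) ^ m * - (qTri m * recipSum m)
      ∎
    where
    pointwise : ∀ {n} → n ≤ m → V n * ((- b) ^ (m ∸ n) * qTri (m ∸ n)) ≈ (- b) ^ m * (weight n * ((- 1#) ^ n * qTri (m ∸ n)))
    pointwise {n} n≤m = begin
      weight n * b ^ n * ((- b) ^ (m ∸ n) * qTri (m ∸ n))
        ≈⟨ *-congʳ (*-congˡ (trans (^-cong n (solve 1 (λ b → b := (:- 𝟙) :* (:- b)) refl b)) (^-distrib-* (- 1#) (- b) n))) ⟩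
      weight n * ((- 1#) ^ n * (- b) ^ n) * ((- b) ^ (m ∸ n) * qTri (m ∸ n))
        ≈⟨ solve 5 (λ W S B B′ T → W :* (S :* B) :* (B′ :* T) := B :* B′ :* (W :* (S :* T)))
           refl (weight n) ((- 1#) ^ n) ((- b) ^ n) ((- b) ^ (m ∸ n)) (qTri (m ∸ n)) ⟩
      (- b) ^ n * (- b) ^ (m ∸ n) * (weight n * ((- 1#) ^ n * qTri (m ∸ n)))
        ≈⟨ *-congʳ (^-homo-∸ (- b) n≤m) ⟩
      (- b) ^ m * (weight n * ((- 1#) ^ n * qTri (m ∸ n)))
        ∎

  cleared-identity : ∀ N → qfac N ≉0 → poch q a N ≉0 → poch q b N ≉0 →
    ∑[ n < suc N ] (gauss N n * (U n * poch q (b * q ^ n) (N ∸ n)))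
      ≈ ∑[ n < suc N ] (gauss N n * (V n * poch q b (N ∸ n))) - poch q b N * logSum b N
  cleared-identity N qN≉0 PaN≉0 PbN≉0 = begin
    ∑[ n < suc N ] (gauss N n * (U n * poch q (b * q ^ n) (N ∸ n)))
      ≈⟨ poch-resummation N U (λ n → b * q ^ n) qN≉0 ⟩
    ∑[ m < suc N ] (gauss N m * ∑[ n < suc m ] (gauss m n * (U n * ((- (b * q ^ n)) ^ (m ∸ n) * qTri (m ∸ n)))))
      ≈⟨ ∑-cong (suc N) (λ m m≤N → *-congˡ (inner-U m (Pa m≤N))) ⟩
    ∑[ m < suc N ] (gauss N m * ((- b) ^ m * qTri m * - logSum a m))
      ≈⟨ ∑-cong (suc N) (λ m m≤N → split m (Pa m≤N)) ⟩
    ∑[ m < suc N ] (gauss N m * ((- b) ^ m * - (qTri m * recipSum m)) + gauss N m * (m × 1# * ((- b) ^ m * qTri m)))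
      ≈⟨ ∑-distrib-+ (suc N) _ _ ⟩
    ∑[ m < suc N ] (gauss N m * ((- b) ^ m * - (qTri m * recipSum m))) + ∑[ m < suc N ] (gauss N m * (m × 1# * ((- b) ^ m * qTri m)))
      ≈⟨ +-cong (∑-cong (suc N) (λ m m≤N → *-congˡ (inner-V m (Pa m≤N))) ) (sym (q-binomial-theorem-derivative N b PbN≉0)) ⟨
    ∑[ m < suc N ] (gauss N m * ∑[ n < suc m ] (gauss m n * (V n * ((- b) ^ (m ∸ n) * qTri (m ∸ n))))) + - (poch q b N * logSum b N)
      ≈⟨ +-congʳ (poch-resummation N V (λ _ → b) qN≉0) ⟨
    ∑[ n < suc N ] (gauss N n * (V n * poch q b (N ∸ n))) - poch q b N * logSum b N
      ∎
    where
    Pa : ∀ {m} → m < suc N → poch q a m ≉0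
    Pa m<1+N = poch-≉0-≤ a PaN≉0 (ℕ.≤-pred m<1+N)
    split : ∀ m → poch q a m ≉0 →
      gauss N m * ((- b) ^ m * qTri m * - logSum a m)
        ≈ gauss N m * ((- b) ^ m * - (qTri m * recipSum m)) + gauss N m * (m × 1# * ((- b) ^ m * qTri m))
    split m Pm≉0 = begin
      gauss N m * ((- b) ^ m * qTri m * - logSum a m)
        ≈⟨ solve 5 (λ X B T L M → X :* (B :* T :* (:- L)) := X :* (B :* (:- (T :* (L :+ M)))) :+ X :* (M :* (B :* T)))
           refl (gauss N m) ((- b) ^ m) (qTri m) (logSum a m) (m × 1#) ⟩
      gauss N m * ((- b) ^ m * - (qTri m * (logSum a m + m × 1#))) + gauss N m * (m × 1# * ((- b) ^ m * qTri m))
        ≈⟨ +-congʳ (*-congˡ (*-congˡ (-‿cong (*-congˡ (recipSum≈logSum+m m Pm≉0))))) ⟨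
      gauss N m * ((- b) ^ m * - (qTri m * recipSum m)) + gauss N m * (m × 1# * ((- b) ^ m * qTri m))
        ∎

module Specialisation {c ℓ : Level} (F : Field c ℓ) (N : ℕ) (q z e : Field.Carrier F) where
  a b : Field.Carrier F
  a = FieldOps._/_ F q e
  b = Field._*_ F z q

  open ClearedIdentity F q a b public

  lhs-summand rhs-summand correction : ℕ → Carrier
  lhs-summand n = qbinom q N n * ((qfac (n ∸ 1) * z ^ n * q ^ (n *ℕ suc n)) / (poch q b n * poch q a n * e ^ n))
  rhs-summand n = qbinom q N n * ((qfac (n ∸ 1) * poch q b (N ∸ n) * b ^ n) / (poch q b N * poch q a n))
  correction  n = z * q ^ n / (1# - z * q ^ n)

  power-identity : ∀ n → z ^ n * q ^ (n *ℕ suc n) * (e ⁻¹) ^ n ≈ b ^ n * a ^ n * (qTri n * qTri n)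
  power-identity n = begin
    z ^ n * q ^ (n *ℕ suc n) * (e ⁻¹) ^ n
      ≈⟨ *-congʳ (*-congˡ (qTri-double n)) ⟩
    z ^ n * (qTri n * qTri n * (q ^ n * q ^ n)) * (e ⁻¹) ^ n
      ≈⟨ solve 5 (λ Z T Q Q′ E → Z :* (T :* T :* (Q :* Q′)) :* E := Z :* Q :* (Q′ :* E) :* (T :* T))
         refl (z ^ n) (qTri n) (q ^ n) (q ^ n) ((e ⁻¹) ^ n) ⟩
    z ^ n * q ^ n * (q ^ n * (e ⁻¹) ^ n) * (qTri n * qTri n)
      ≈⟨ *-congʳ (*-cong (^-distrib-* z q n) (^-distrib-* q (e ⁻¹) n)) ⟨
    b ^ n * a ^ n * (qTri n * qTri n)
      ∎

  lhs-cleared : qfac N ≉0 → e ≉0 → poch q a N ≉0 → poch q b N ≉0 →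
                poch q b N * sum1 N lhs-summand ≈ ∑[ n < suc N ] (gauss N n * (U n * poch q (b * q ^ n) (N ∸ n)))
  lhs-cleared qN≉0 e≉0 PaN≉0 PbN≉0 = *-sum1 N _ lhs-summand _ (y≈0⇒x*y≈0 1# (x≈0⇒x*y≈0 _ (zeroˡ _))) pointwise
    where
    pointwise : ∀ j → j < N → poch q b N * lhs-summand (suc j) ≈ gauss N (suc j) * (U (suc j) * poch q (b * q ^ suc j) (N ∸ suc j))
    pointwise j j<N = begin
      poch q b N * (qbinom q N n * ((qfac j * z ^ n * q ^ (n *ℕ suc n)) * (Pb * Pa * e ^ n) ⁻¹))
        ≈⟨ *-cong (poch-split b j<N) (*-cong (qbinom≈gauss qN≉0 j<N) (*-congˡ inverse)) ⟩
      Pb * R * (gauss N n * ((qfac j * z ^ n * q ^ (n *ℕ suc n)) * (Pb ⁻¹ * Pa ⁻¹ * (e ⁻¹) ^ n)))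
        ≈⟨ solve 9 (λ P R X Q Z T P′ A′ E′ →
                      P :* R :* (X :* (Q :* Z :* T :* (P′ :* A′ :* E′)))
                      := X :* (Q :* A′ :* (Z :* T :* E′) :* R) :* (P :* P′))
           refl Pb R (gauss N n) (qfac j) (z ^ n) (q ^ (n *ℕ suc n)) (Pb ⁻¹) (Pa ⁻¹) ((e ⁻¹) ^ n) ⟩
      gauss N n * (weight n * (z ^ n * q ^ (n *ℕ suc n) * (e ⁻¹) ^ n) * R) * (Pb * Pb ⁻¹)
        ≈⟨ *-cong (*-congˡ (*-congʳ (*-congˡ (power-identity n)))) (inverseʳ Pb Pb≉0) ⟩
      gauss N n * (U n * R) * 1#
        ≈⟨ *-identityʳ _ ⟩
      gauss N n * (U n * R)
        ∎
      where
      n : ℕ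
      n = suc j
      Pb Pa R : Carrier
      Pb = poch q b n
      Pa = poch q a n
      R  = poch q (b * q ^ n) (N ∸ n)
      Pb≉0 : Pb ≉0
      Pb≉0 = poch-≉0-≤ b PbN≉0 j<N
      Pa≉0 : Pa ≉0
      Pa≉0 = poch-≉0-≤ a PaN≉0 j<N
      inverse : (Pb * Pa * e ^ n) ⁻¹ ≈ Pb ⁻¹ * Pa ⁻¹ * (e ⁻¹) ^ n
      inverse = trans (⁻¹-distrib-* (*-≉0 Pb≉0 Pa≉0) (^-≉0 n e≉0)) (*-cong (⁻¹-distrib-* Pb≉0 Pa≉0) (^-⁻¹ n e≉0))

  rhs-cleared : qfac N ≉0 → poch q a N ≉0 → poch q b N ≉0 →
                poch q b N * sum1 N rhs-summand ≈ ∑[ n < suc N ] (gauss N n * (V n * poch q b (N ∸ n)))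
  rhs-cleared qN≉0 PaN≉0 PbN≉0 = *-sum1 N _ rhs-summand _ (y≈0⇒x*y≈0 1# (x≈0⇒x*y≈0 _ (zeroˡ _))) pointwise
    where
    pointwise : ∀ j → j < N → poch q b N * rhs-summand (suc j) ≈ gauss N (suc j) * (V (suc j) * poch q b (N ∸ suc j))
    pointwise j j<N = begin
      P * (qbinom q N n * ((qfac j * R * b ^ n) * (P * Pa) ⁻¹))
        ≈⟨ *-congˡ (*-cong (qbinom≈gauss qN≉0 j<N) (*-congˡ (⁻¹-distrib-* PbN≉0 Pa≉0))) ⟩
      P * (gauss N n * ((qfac j * R * b ^ n) * (P ⁻¹ * Pa ⁻¹)))
        ≈⟨ solve 7 (λ P X Q R B P′ A′ → P :* (X :* (Q :* R :* B :* (P′ :* A′))) := X :* (Q :* A′ :* B :* R) :* (P :* P′))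
           refl P (gauss N n) (qfac j) R (b ^ n) (P ⁻¹) (Pa ⁻¹) ⟩
      gauss N n * (V n * R) * (P * P ⁻¹)
        ≈⟨ *-congˡ (inverseʳ P PbN≉0) ⟩
      gauss N n * (V n * R) * 1#
        ≈⟨ *-identityʳ _ ⟩
      gauss N n * (V n * R)
        ∎
      where
      n : ℕ
      n = suc j
      P Pa R : Carrier
      P  = poch q b N
      Pa = poch q a n
      R  = poch q b (N ∸ n)
      Pa≉0 : Pa ≉0
      Pa≉0 = poch-≉0-≤ a PaN≉0 j<N

  correction-sum : poch q b N ≉0 → sum1 N correction ≈ logSum b N
  correction-sum PbN≉0 = trans (sum1≈∑< N correction) (∑-cong N pointwise)
    where
    pointwise : ∀ k → k < N → correction (suc k) ≈ b * q ^ k * factor b k ⁻¹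
    pointwise k k<N = *-cong zq≈bq (⁻¹-cong (+-congˡ (-‿cong zq≈bq)) (factor-≉0 b PbN≉0 k<N))
      where
      zq≈bq : z * q ^ suc k ≈ b * q ^ k
      zq≈bq = solve 3 (λ z Q q → z :* (Q :* q) := z :* q :* Q) refl z (q ^ k) q

theorem5p8 : ∀ {c ℓ : Level} (F : Field c ℓ) →
  let open FieldOps F in
  (N : ℕ) (q z e : Carrier) →
  ¬ (e ≈ 0#) →
  -- denominators of the q-binomial coefficients [N n], 1 ≤ n ≤ N
  (∀ n → 1 ≤ n → n ≤ N → ¬ ((poch q q n * poch q q (N ∸ n)) ≈ 0#)) →
  -- the other denominators (zq)_n, (q/e)_n, (zq)_N, 1 - z q^n
  (∀ n → 1 ≤ n → n ≤ N → ¬ (poch q (z * q) n ≈ 0#)) →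
  (∀ n → 1 ≤ n → n ≤ N → ¬ (poch q (q / e) n ≈ 0#)) →
  ¬ (poch q (z * q) N ≈ 0#) →
  (∀ n → 1 ≤ n → n ≤ N → ¬ ((1# - z * (q ^ n)) ≈ 0#)) →
  sum1 N (λ n → qbinom q N n
                * ((poch q q (n ∸ 1) * (z ^ n) * (q ^ (n *ℕ sucℕ n)))
                   / (poch q (z * q) n * poch q (q / e) n * (e ^ n))))
    ≈ (sum1 N (λ n → qbinom q N n
                * ((poch q q (n ∸ 1) * poch q (z * q) (N ∸ n) * ((z * q) ^ n))
                   / (poch q (z * q) N * poch q (q / e) n)))
       - sum1 N (λ n → (z * (q ^ n)) / (1# - z * (q ^ n))))
-- The hypotheses on (zq)_n for n < N and on 1 - zqⁿ are implied by (zq)_N ≉ 0.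
theorem5p8 F N q z e e≉0 qbinom-denominators≉0 _ a-pochs≉0 PbN≉0 _ = *-cancelʳ PbN≉0 (begin
  sum1 N lhs-summand * Pb
    ≈⟨ *-comm _ Pb ⟩
  Pb * sum1 N lhs-summand
    ≈⟨ lhs-cleared qN≉0 e≉0 PaN≉0 PbN≉0 ⟩
  ∑[ n < suc N ] (gauss N n * (U n * poch q (b * q ^ n) (N ∸ n)))
    ≈⟨ cleared-identity N qN≉0 PaN≉0 PbN≉0 ⟩
  ∑[ n < suc N ] (gauss N n * (V n * poch q b (N ∸ n))) - Pb * logSum b N
    ≈⟨ +-cong (rhs-cleared qN≉0 PaN≉0 PbN≉0) (-‿cong (*-congˡ (correction-sum PbN≉0))) ⟨
  Pb * sum1 N rhs-summand - Pb * sum1 N correction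
    ≈⟨ solve 3 (λ P R C → P :* R :- P :* C := (R :- C) :* P) refl Pb (sum1 N rhs-summand) (sum1 N correction) ⟩
  (sum1 N rhs-summand - sum1 N correction) * Pb
    ∎)
  where
  open Specialisation F N q z e
  Pb : Carrier
  Pb = poch q b N
  at-top : ∀ {M} (P : ℕ → Carrier) → P 0 ≉0 → (∀ n → 1 ≤ n → n ≤ M → P n ≉0) → P M ≉0
  at-top {zero}  P P0≉0 _   = P0≉0
  at-top {suc M} P _    Pn≉0 = Pn≉0 (suc M) (s≤s z≤n) ℕ.≤-refl
  qN≉0 : qfac N ≉0
  qN≉0 = at-top qfac 1≉0 (λ n 1≤n n≤N → ≉0-*ˡ (qbinom-denominators≉0 n 1≤n n≤N))
  PaN≉0 : poch q a N ≉0
  PaN≉0 = at-top (poch q a) 1≉0 a-pochs≉0
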